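{- Let $(C,\phi)$ be a multistate monotone system with component state sets $\mathcal{S}_i=\{0,1,\ldots,m_i\}$, $m_i\ge1$, and let $k\in\{1,\ldots,M\}$. For $B\subseteq C$ define $\bm{x}(B)$ by $x_i(B)=m_i$ for $i\in B$ and $x_i(B)=m_i-1$ otherwise. Then $$d(\phi_k)=\sum_{B\subseteq C}\phi_k(\bm{x}(B))\,(-1)^{|C|-|B|}.$$
   Context: A multistate monotone system (MMS) $(C,\phi)$ has component set $C=\{1,\ldots,n\}$, component state sets $\mathcal{S}_i=\{0,1,\ldots,m_i\}$, component state space $\mathfrak{C}=\mathcal{S}_1\times\cdots\times\mathcal{S}_n$, system state set $\{0,1,\ldots,M\}$, and a structure function $\phi:\mathfrak{C}\to\{0,\ldots,M\}$ non-decreasing in each argument; $\phi_k(\bm{x})=\mathrm{I}(\phi(\bm{x})\ge k)$. Vectors are ordered componentwise. A minimal $k$-level path vector is $\bm{x}\in\mathfrak{C}$ with $\phi(\bm{x})\ge k$ and $\phi(\bm{y})<k$ for all $\bm{y}\le\bm{x}$, $\bm{y}\ne\bm{x}$; $\mathfrak{P}_k$ is the set of these, and $\mathrm{cl}(\mathfrak{P}_k)$ is the smallest set containing $\mathfrak{P}_k$ closed under componentwise maximum $\vee$. A formation of $\bm{x}\in\mathrm{cl}(\mathfrak{P}_k)$ is a nonempty subset $\{\bm{x}_{i_1},\ldots,\bm{x}_{i_j}\}\subseteq\mathfrak{P}_k$ with $\bm{x}=\bm{x}_{i_1}\vee\cdots\vee\bm{x}_{i_j}$, odd/even according to parity of $j$.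 $\delta_k(\bm{x})=$ (number of odd formations) $-$ (number of even formations) for $\bm{x}\in\mathrm{cl}(\mathfrak{P}_k)$, $\delta_k(\bm{x})=0$ otherwise. The signed domination of $\phi_k$ is $d(\phi_k)=\delta_k(\bm{m})$, $\bm{m}=(m_1,\ldots,m_n)$. -}

module Defs where

open import Data.Nat using (ℕ; zero; suc; _≤_; _<_; _∸_; _≤ᵇ_; _<ᵇ_; _≡ᵇ_; s≤s)
open import Data.Nat.Properties using (m∸n≤m)
open import Data.Bool using (Bool; true; false; _∧_; _∨_; not; if_then_else_)
open import Data.Fin using (Fin; zero; suc; toℕ; fromℕ; fromℕ<)
open import Data.List using (List; []; _∷_; map; concatMap; filter; foldr; length; _++_)
open import Data.Bool.ListAction using (all)
open import Data.Vec using (Vec; []; _∷_; lookup)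
open import Data.Fin.Subset using (Subset; Side; inside; outside; ∣_∣)
open import Data.Integer using (ℤ; +_; -_; _+_; _^_)
open import Relation.Nullary.Decidable using (T?)

State : {n : ℕ} → (Fin n → ℕ) → Set
State {n} m = (i : Fin n) → Fin (suc (m i))

_≤ₛ_ : {n : ℕ} {m : Fin n → ℕ} → State m → State m → Set
x ≤ₛ y = ∀ i → toℕ (x i) ≤ toℕ (y i)

Monotone : {n : ℕ} {m : Fin n → ℕ} {M : ℕ} → (State m → Fin (suc M)) → Set
Monotone {m = m} φ = ∀ (x y : State m) → x ≤ₛ y → toℕ (φ x) ≤ toℕ (φ y)

topState : {n : ℕ} (m : Fin n → ℕ) → State m
topState m i = fromℕ (m i)

allFinL : (n : ℕ) → List (Fin n)
allFinL zero    = []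
allFinL (suc n) = zero ∷ map suc (allFinL n)

allFinBounded : (k : ℕ) → List (Fin (suc k))
allFinBounded k = allFinL (suc k)

leₛᵇ : {n : ℕ} {m : Fin n → ℕ} → State m → State m → Bool
leₛᵇ {n} x y = all (λ i → toℕ (x i) ≤ᵇ toℕ (y i)) (allFinL n)

eqₛᵇ : {n : ℕ} {m : Fin n → ℕ} → State m → State m → Bool
eqₛᵇ {n} x y = all (λ i → toℕ (x i) ≡ᵇ toℕ (y i)) (allFinL n)

maxFin : {k : ℕ} → Fin k → Fin k → Fin k
maxFin a b = if toℕ a ≤ᵇ toℕ b then b else a

_∨ₛ_ : {n : ℕ} {m : Fin n → ℕ} → State m → State m → State m
(x ∨ₛ y) i = maxFin (x i) (y i)

allStates : {n : ℕ} (m : Fin n → ℕ) → List (State m)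
allStates {zero}  m = (λ ()) ∷ []
allStates {suc n} m =
  concatMap (λ a → map (λ r → cons a r) (allStates (λ i → m (suc i))))
            (allFinBounded (m zero))
  where
  cons : Fin (suc (m zero)) → State (λ i → m (suc i)) → State m
  cons a r zero    = a
  cons a r (suc i) = r i

φₖ : {n : ℕ} {m : Fin n → ℕ} {M : ℕ} → (State m → Fin (suc M)) → ℕ → State m → ℕ
φₖ φ k x = if k ≤ᵇ toℕ (φ x) then 1 else 0

isMinPathᵇ : {n : ℕ} {m : Fin n → ℕ} {M : ℕ} → (State m → Fin (suc M)) → ℕ → State m → Bool
isMinPathᵇ {m = m} φ k x =
  (k ≤ᵇ toℕ (φ x)) ∧
  all (λ y → not (leₛᵇ y x ∧ not (eqₛᵇ y x)) ∨ (toℕ (φ y) <ᵇ k)) (allStates m)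

minPaths : {n : ℕ} {m : Fin n → ℕ} {M : ℕ} → (State m → Fin (suc M)) → ℕ → List (State m)
minPaths {m = m} φ k = filter (λ x → T? (isMinPathᵇ φ k x)) (allStates m)

sublists : {A : Set} → List A → List (List A)
sublists []       = [] ∷ []
sublists (a ∷ as) = let r = sublists as in map (a ∷_) r ++ r

-- does the nonempty collection S have join (componentwise max) equal to x?
-- (the empty collection is never a formation)
joinIsᵇ : {n : ℕ} {m : Fin n → ℕ} → List (State m) → State m → Bool
joinIsᵇ []      x = false
joinIsᵇ (s ∷ S) x = eqₛᵇ (foldr _∨ₛ_ s S) x

paritySign : ℕ → ℤ
paritySign zero          = - (+ 1)
paritySign (suc zero)    = + 1
paritySign (suc (suc j)) = paritySign j

sumℤ : List ℤ → ℤ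
sumℤ = foldr _+_ (+ 0)

-- δₖ(x) = #odd formations − #even formations of x.
-- If x ∉ cl(𝔓ₖ) then x has no formations and the sum is 0, as required.
δ : {n : ℕ} {m : Fin n → ℕ} {M : ℕ} → (State m → Fin (suc M)) → ℕ → State m → ℤ
δ φ k x =
  sumℤ (map (λ S → if joinIsᵇ S x then paritySign (length S) else + 0)
            (sublists (minPaths φ k)))

signedDomination : {n : ℕ} {m : Fin n → ℕ} {M : ℕ} → (State m → Fin (suc M)) → ℕ → ℤ
signedDomination {m = m} φ k = δ φ k (topState m)

allSubsets : (n : ℕ) → List (Subset n)
allSubsets zero    = [] ∷ []
allSubsets (suc n) =
  map (inside ∷_) (allSubsets n) ++ map (outside ∷_) (allSubsets n)

xOf : {n : ℕ} (m : Fin n → ℕ) → Subset n → State m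
xOf m B i with lookup B i
... | inside  = fromℕ (m i)
... | outside = fromℕ< (s≤s (m∸n≤m (m i) 1))

rhs : {n : ℕ} {m : Fin n → ℕ} {M : ℕ} → (State m → Fin (suc M)) → ℕ → ℤ
rhs {n} {m} φ k =
  sumℤ (map (λ B → (+ φₖ φ k (xOf m B)) Data.Integer.* ((- (+ 1)) ^ (n ∸ ∣ B ∣)))
            (allSubsets n))

-- Over the box {m − 1, m}ⁿ the alternating sum Σ_B (−1)^{n−|B|} [z ≤ x(B)] is the
-- indicator of z = m.  Taking z to be the join of a family S of minimal path vectors,
-- δₖ(m) = Σ_S (−1)^{|S|+1} [⋁S = m] becomes Σ_B (−1)^{n−|B|} Σ_S (−1)^{|S|+1} [⋁S ≤ x(B)],
-- and by inclusion–exclusion the inner sum is [some minimal path vector lies below x(B)],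
-- which for a monotone φ is φₖ(x(B)).
module Submission where

open import Defs
open import Algebra.Bundles using (CommutativeMonoid)
import Algebra.Properties.CommutativeSemigroup as CommutativeSemigroupProperties
open import Data.Bool using (Bool; true; false; _∧_; _∨_; not; if_then_else_; T)
open import Data.Bool.ListAction using (and; all; any)
import Data.Bool.Properties as BP
open import Data.Empty using (⊥-elim)
open import Data.Fin using (Fin; zero; suc; toℕ)
import Data.Fin.Properties as FP
open import Data.Fin.Subset using (Subset; Side; inside; outside; ∣_∣)
open import Data.Vec using (_∷_; lookup)
open import Data.Fin.Subset.Properties using (∣p∣≤n)
open import Data.Integer using (ℤ; +_; -_; _+_; _*_; _^_; -1ℤ; 1ℤ)
import Data.Integer.Properties as ZP
open import Data.List using (List; []; _∷_; map; foldr; length; _++_)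
import Data.List.Properties as LP
open import Data.List.Membership.Propositional using (_∈_; find; lose)
open import Data.List.Membership.Propositional.Properties
  using (∈-map⁺; ∈-concatMap⁺; ∈-filter⁺; ∈-filter⁻)
import Data.List.Relation.Unary.All as All
open import Data.List.Relation.Unary.All.Properties using (all⁺; all⁻; ¬All⇒Any¬)
open import Data.List.Relation.Unary.Any using (here; there; satisfied)
open import Data.List.Relation.Unary.Any.Properties using (any⁺; any⁻)
open import Data.Nat using (ℕ; zero; suc; _≤_; _<_; _∸_; _≤ᵇ_; _<ᵇ_; _≡ᵇ_; s≤s; z≤n)
open import Data.Nat.Induction using (<-wellFounded)
open import Data.Nat.ListAction using (sum)
open import Data.Nat.Properties
  using (≤-trans; ≤-reflexive; <⇒≤; ≰⇒>; ≮⇒≥; ≤∧≢⇒<; +-mono-≤; +-mono-<-≤; +-mono-≤-<)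
open import Data.Nat.Properties using (≤ᵇ⇒≤; ≤⇒≤ᵇ; <⇒<ᵇ; ≡⇒≡ᵇ; +-∸-assoc)
open import Data.Product using (∃-syntax; _×_; _,_; proj₁; proj₂)
open import Function using (_∘_; Equivalence)
open import Induction.WellFounded using (Acc; acc)
open import Relation.Binary.PropositionalEquality
  using (_≡_; _≢_; refl; sym; trans; cong; cong₂; subst; module ≡-Reasoning)
open import Relation.Nullary using (¬_; yes; no)
open import Relation.Nullary.Decidable using (T?)

private
  module +ℤ = CommutativeSemigroupProperties ZP.+-commutativeSemigroup
  module ∧ = CommutativeSemigroupProperties (CommutativeMonoid.commutativeSemigroup BP.∧-commutativeMonoid)

private
  variable
    A B : Set

when : Bool → ℤ → ℤ
when b x = if b then x else + 0

∑ : List A → (A → ℤ) → ℤ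
∑ L f = sumℤ (map f L)

infix 5 ∑
syntax ∑ L (λ x → e) = ∑[ x ∈ L ] e

∑-++ : (xs ys : List A) (f : A → ℤ) → ∑ (xs ++ ys) f ≡ ∑ xs f + ∑ ys f
∑-++ []       ys f = sym (ZP.+-identityˡ _)
∑-++ (x ∷ xs) ys f = trans (cong (_+_ (f x)) (∑-++ xs ys f)) (sym (ZP.+-assoc (f x) _ _))

∑-map : (g : B → A) (L : List B) (f : A → ℤ) → ∑ (map g L) f ≡ ∑ L (f ∘ g)
∑-map g L f = cong sumℤ (sym (LP.map-∘ L))

∑-cong : {f g : A → ℤ} → (∀ x → f x ≡ g x) → (L : List A) → ∑ L f ≡ ∑ L g
∑-cong f≗g L = cong sumℤ (LP.map-cong f≗g L)

∑-zero : (L : List A) → ∑[ x ∈ L ] + 0 ≡ + 0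
∑-zero []      = refl
∑-zero (_ ∷ L) = trans (ZP.+-identityˡ _) (∑-zero L)

∑-neg : (f : A → ℤ) (L : List A) → ∑[ x ∈ L ] - f x ≡ - ∑ L f
∑-neg f []      = refl
∑-neg f (x ∷ L) = trans (cong (_+_ (- f x)) (∑-neg f L)) (sym (ZP.neg-distrib-+ (f x) _))

∑-*ˡ : (c : ℤ) (f : A → ℤ) (L : List A) → c * ∑ L f ≡ ∑[ x ∈ L ] c * f x
∑-*ˡ c f []      = ZP.*-zeroʳ c
∑-*ˡ c f (x ∷ L) = trans (ZP.*-distribˡ-+ c (f x) _) (cong (_+_ (c * f x)) (∑-*ˡ c f L))

∑-*ʳ : (c : ℤ) (f : A → ℤ) (L : List A) → ∑ L f * c ≡ ∑[ x ∈ L ] f x * c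
∑-*ʳ c f []      = refl
∑-*ʳ c f (x ∷ L) = trans (ZP.*-distribʳ-+ c (f x) _) (cong (_+_ (f x * c)) (∑-*ʳ c f L))

∑-when : (b : Bool) (f : A → ℤ) (L : List A) → ∑[ x ∈ L ] when b (f x) ≡ when b (∑ L f)
∑-when true  f L = refl
∑-when false f L = ∑-zero L

∑-+ : (f g : A → ℤ) (L : List A) → ∑[ x ∈ L ] (f x + g x) ≡ ∑ L f + ∑ L g
∑-+ f g []      = refl
∑-+ f g (x ∷ L) = trans (cong (_+_ (f x + g x)) (∑-+ f g L)) (+ℤ.interchange (f x) (g x) _ _)

∑-sublists-∷ : (g : List A → ℤ) (a : A) (as : List A) →
               ∑ (sublists (a ∷ as)) g ≡ (∑[ S ∈ sublists as ] g (a ∷ S)) + ∑ (sublists as) g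
∑-sublists-∷ g a as =
  trans (∑-++ (map (a ∷_) (sublists as)) (sublists as) g)
        (cong (_+ ∑ (sublists as) g) (∑-map (a ∷_) (sublists as) g))

∑-comm : (f : A → B → ℤ) (L : List A) (K : List B) →
         ∑[ x ∈ L ] ∑[ y ∈ K ] f x y ≡ ∑[ y ∈ K ] ∑[ x ∈ L ] f x y
∑-comm f []      K = sym (∑-zero K)
∑-comm f (x ∷ L) K =
  trans (cong (_+_ (∑[ y ∈ K ] f x y)) (∑-comm f L K)) (sym (∑-+ (f x) (λ y → ∑[ x ∈ L ] f x y) K))

when-∧ : (a b : Bool) (x : ℤ) → when (a ∧ b) x ≡ when a (when b x)
when-∧ true  b x = refl
when-∧ false b x = refl

when-neg : (b : Bool) (x : ℤ) → when b (- x) ≡ - when b x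
when-neg true  x = refl
when-neg false x = refl

when-*-comm : (b : Bool) (x y : ℤ) → x * when b y ≡ when b x * y
when-*-comm true  x y = refl
when-*-comm false x y = ZP.*-zeroʳ x

when-1 : (b : Bool) (x : ℤ) → when b x ≡ x * when b 1ℤ
when-1 true  x = sym (ZP.*-identityʳ x)
when-1 false x = sym (ZP.*-zeroʳ x)

T-ext : {a b : Bool} → (T a → T b) → (T b → T a) → a ≡ b
T-ext {false} {false} _ _ = refl
T-ext {false} {true}  _ b⇒a = ⊥-elim (b⇒a _)
T-ext {true}  {false} a⇒b _ = ⊥-elim (a⇒b _)
T-ext {true}  {true}  _ _ = refl

-- Inclusion–exclusion over the sublists of a list

paritySign-suc : ∀ j → paritySign (suc j) ≡ - paritySign j
paritySign-suc zero          = refl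
paritySign-suc (suc zero)    = refl
paritySign-suc (suc (suc j)) = paritySign-suc j

module _ {A : Set} (f : A → Bool) where

  signedAll : List A → ℤ
  signedAll S = when (all f S) (paritySign (length S))

  signedAll⁺ : List A → ℤ
  signedAll⁺ []      = + 0
  signedAll⁺ (s ∷ S) = signedAll (s ∷ S)

  signedAll-∷ : (a : A) (S : List A) → signedAll (a ∷ S) ≡ when (f a) (- signedAll S)
  signedAll-∷ a S = begin
    when (f a ∧ all f S) (paritySign (suc (length S)))   ≡⟨ when-∧ (f a) _ _ ⟩
    when (f a) (when (all f S) (paritySign (suc (length S))))
      ≡⟨ cong (λ σ → when (f a) (when (all f S) σ)) (paritySign-suc (length S)) ⟩
    when (f a) (when (all f S) (- paritySign (length S)))
      ≡⟨ cong (when (f a)) (when-neg (all f S) _) ⟩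
    when (f a) (- signedAll S)                           ∎
    where open ≡-Reasoning

  ∑-sublists-signedAll-∷ : (a : A) (as : List A) →
                           ∑[ S ∈ sublists as ] signedAll (a ∷ S) ≡ when (f a) (- ∑ (sublists as) signedAll)
  ∑-sublists-signedAll-∷ a as = begin
    ∑[ S ∈ sublists as ] signedAll (a ∷ S)            ≡⟨ ∑-cong (signedAll-∷ a) (sublists as) ⟩
    ∑[ S ∈ sublists as ] when (f a) (- signedAll S)   ≡⟨ ∑-when (f a) (-_ ∘ signedAll) (sublists as) ⟩
    when (f a) (∑[ S ∈ sublists as ] - signedAll S)   ≡⟨ cong (when (f a)) (∑-neg signedAll (sublists as)) ⟩
    when (f a) (- ∑ (sublists as) signedAll)          ∎
    where open ≡-Reasoning

  ∑-sublists-signedAll : (L : List A) → ∑ (sublists L) signedAll ≡ when (not (any f L)) -1ℤ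
  ∑-sublists-signedAll []       = refl
  ∑-sublists-signedAll (a ∷ as) = begin
    ∑ (sublists (a ∷ as)) signedAll
      ≡⟨ ∑-sublists-∷ signedAll a as ⟩
    (∑[ S ∈ sublists as ] signedAll (a ∷ S)) + ∑ (sublists as) signedAll
      ≡⟨ cong (_+ _) (∑-sublists-signedAll-∷ a as) ⟩
    when (f a) (- ∑ (sublists as) signedAll) + ∑ (sublists as) signedAll
      ≡⟨ cong (λ x → when (f a) (- x) + x) (∑-sublists-signedAll as) ⟩
    when (f a) (- when (not (any f as)) -1ℤ) + when (not (any f as)) -1ℤ
      ≡⟨ combine (f a) (any f as) ⟩
    when (not (f a ∨ any f as)) -1ℤ ∎
    where
    open ≡-Reasoning
    combine : ∀ b c → when b (- when (not c) -1ℤ) + when (not c) -1ℤ ≡ when (not (b ∨ c)) -1ℤ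
    combine false false = refl
    combine false true  = refl
    combine true  false = refl
    combine true  true  = refl

  ∑-sublists-signedAll⁺ : (L : List A) → ∑ (sublists L) signedAll⁺ ≡ when (any f L) 1ℤ
  ∑-sublists-signedAll⁺ []       = refl
  ∑-sublists-signedAll⁺ (a ∷ as) = begin
    ∑ (sublists (a ∷ as)) signedAll⁺
      ≡⟨ ∑-sublists-∷ signedAll⁺ a as ⟩
    (∑[ S ∈ sublists as ] signedAll (a ∷ S)) + ∑ (sublists as) signedAll⁺
      ≡⟨ cong (_+ _) (∑-sublists-signedAll-∷ a as) ⟩
    when (f a) (- ∑ (sublists as) signedAll) + ∑ (sublists as) signedAll⁺
      ≡⟨ cong₂ (λ x y → when (f a) (- x) + y) (∑-sublists-signedAll as) (∑-sublists-signedAll⁺ as) ⟩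
    when (f a) (- when (not (any f as)) -1ℤ) + when (any f as) 1ℤ
      ≡⟨ combine (f a) (any f as) ⟩
    when (f a ∨ any f as) 1ℤ ∎
    where
    open ≡-Reasoning
    combine : ∀ b c → when b (- when (not c) -1ℤ) + when c 1ℤ ≡ when (b ∨ c) 1ℤ
    combine false false = refl
    combine false true  = refl
    combine true  false = refl
    combine true  true  = refl

∈-allFinL : ∀ {n} (i : Fin n) → i ∈ allFinL n
∈-allFinL zero    = here refl
∈-allFinL (suc i) = there (∈-map⁺ suc (∈-allFinL i))

all-cong : {f g : A → Bool} → (∀ x → f x ≡ g x) → (L : List A) → all f L ≡ all g L
all-cong f≗g L = cong and (LP.map-cong f≗g L)

all-∧ : (f g : A → Bool) (L : List A) → all (λ x → f x ∧ g x) L ≡ all f L ∧ all g L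
all-∧ f g []      = refl
all-∧ f g (x ∷ L) = trans (cong (_∧_ (f x ∧ g x)) (all-∧ f g L)) (∧.interchange (f x) (g x) _ _)

≤ᵇ-∧-absorb : ∀ {a b} t → a ≤ b → (a ≤ᵇ t) ∧ (b ≤ᵇ t) ≡ (b ≤ᵇ t)
≤ᵇ-∧-absorb {a} {b} t a≤b = T-ext (proj₂ ∘ Equivalence.to BP.T-∧) b≤t⇒both
  where
  b≤t⇒both : T (b ≤ᵇ t) → T ((a ≤ᵇ t) ∧ (b ≤ᵇ t))
  b≤t⇒both b≤t = Equivalence.from BP.T-∧ (≤⇒≤ᵇ (≤-trans a≤b (≤ᵇ⇒≤ b t b≤t)) , b≤t)

max-≤ᵇ : ∀ a b t → ((if a ≤ᵇ b then b else a) ≤ᵇ t) ≡ (a ≤ᵇ t) ∧ (b ≤ᵇ t)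
max-≤ᵇ a b t with a ≤ᵇ b in a≤ᵇb
... | true  = sym (≤ᵇ-∧-absorb t (≤ᵇ⇒≤ a b (subst T (sym a≤ᵇb) _)))
... | false = sym (trans (BP.∧-comm (a ≤ᵇ t) _) (≤ᵇ-∧-absorb t b≤a))
  where
  b≤a : b ≤ a
  b≤a = <⇒≤ (≰⇒> (λ a≤b → subst T a≤ᵇb (≤⇒≤ᵇ a≤b)))

module _ {n : ℕ} {m : Fin n → ℕ} where

  leₛᵇ⇒≤ₛ : {x y : State m} → T (leₛᵇ x y) → x ≤ₛ y
  leₛᵇ⇒≤ₛ {x} {y} x≤y i = ≤ᵇ⇒≤ _ _ (All.lookup (all⁺ _ (allFinL n) x≤y) (∈-allFinL i))

  ≤ₛ⇒leₛᵇ : {x y : State m} → x ≤ₛ y → T (leₛᵇ x y)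
  ≤ₛ⇒leₛᵇ {x} {y} x≤y =
    all⁻ (λ i → toℕ (x i) ≤ᵇ toℕ (y i)) (All.tabulate {xs = allFinL n} (λ {i} _ → ≤⇒≤ᵇ (x≤y i)))

  ¬eqₛᵇ⇒≢ : {x y : State m} → ¬ T (eqₛᵇ x y) → ∃[ i ] toℕ (x i) ≢ toℕ (y i)
  ¬eqₛᵇ⇒≢ {x} {y} x≢y with satisfied (¬All⇒Any¬ (λ i → T? _) (allFinL n) (x≢y ∘ all⁻ _))
  ... | i , xᵢ≢yᵢ = i , xᵢ≢yᵢ ∘ ≡⇒≡ᵇ _ _

  leₛᵇ-∨ₛ : (x y z : State m) → leₛᵇ (x ∨ₛ y) z ≡ leₛᵇ x z ∧ leₛᵇ y z
  leₛᵇ-∨ₛ x y z = trans (all-cong maxᵢ≤zᵢ (allFinL n)) (all-∧ _ _ (allFinL n))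
    where
    maxᵢ≤zᵢ : ∀ i → (toℕ (maxFin (x i) (y i)) ≤ᵇ toℕ (z i))
                      ≡ (toℕ (x i) ≤ᵇ toℕ (z i)) ∧ (toℕ (y i) ≤ᵇ toℕ (z i))
    maxᵢ≤zᵢ i = trans (cong (_≤ᵇ toℕ (z i)) (BP.if-float toℕ (toℕ (x i) ≤ᵇ toℕ (y i))))
                      (max-≤ᵇ (toℕ (x i)) (toℕ (y i)) (toℕ (z i)))

  leₛᵇ-join : (s : State m) (S : List (State m)) (y : State m) →
              leₛᵇ (foldr _∨ₛ_ s S) y ≡ all (λ p → leₛᵇ p y) (s ∷ S)
  leₛᵇ-join s []      y = sym (BP.∧-identityʳ _)
  leₛᵇ-join s (t ∷ S) y =
    trans (leₛᵇ-∨ₛ t _ y)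
          (trans (cong (_∧_ (leₛᵇ t y)) (leₛᵇ-join s S y)) (∧.x∙yz≈y∙xz (leₛᵇ t y) (leₛᵇ s y) _))

-- Only up to pointwise equality: State m is a function type.
allStates-complete : ∀ {n} (m : Fin n → ℕ) (x : State m) → ∃[ z ] z ∈ allStates m × (∀ i → z i ≡ x i)
allStates-complete {zero}  m x = _ , here refl , λ ()
allStates-complete {suc n} m x with allStates-complete (m ∘ suc) (x ∘ suc)
... | r , r∈ , r≗ =
  _ , ∈-concatMap⁺ _ (lose (∈-allFinL (x zero)) (∈-map⁺ _ r∈)) , λ { zero → refl ; (suc i) → r≗ i }

sum-map-≤ : {f g : A → ℕ} → (∀ x → f x ≤ g x) → (L : List A) → sum (map f L) ≤ sum (map g L)
sum-map-≤ f≤g []      = z≤n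
sum-map-≤ f≤g (x ∷ L) = +-mono-≤ (f≤g x) (sum-map-≤ f≤g L)

sum-map-< : {f g : A → ℕ} {x : A} (L : List A) → (∀ y → f y ≤ g y) → x ∈ L → f x < g x →
            sum (map f L) < sum (map g L)
sum-map-< (_ ∷ L) f≤g (here refl) fx<gx = +-mono-<-≤ fx<gx (sum-map-≤ f≤g L)
sum-map-< (y ∷ L) f≤g (there x∈L) fx<gx = +-mono-≤-< (f≤g y) (sum-map-< L f≤g x∈L fx<gx)

module _ {n : ℕ} {m : Fin n → ℕ} where

  ≤ₛ-trans : {x y z : State m} → x ≤ₛ y → y ≤ₛ z → x ≤ₛ z
  ≤ₛ-trans x≤y y≤z i = ≤-trans (x≤y i) (y≤z i)

  ≗⇒≤ₛ : {x y : State m} → (∀ i → x i ≡ y i) → x ≤ₛ y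
  ≗⇒≤ₛ x≗y i = ≤-reflexive (cong toℕ (x≗y i))

  weight : State m → ℕ
  weight x = sum (map (toℕ ∘ x) (allFinL n))

  weight-cong : {x y : State m} → (∀ i → x i ≡ y i) → weight x ≡ weight y
  weight-cong x≗y = cong sum (LP.map-cong (cong toℕ ∘ x≗y) (allFinL n))

  weight-< : {x y : State m} (i : Fin n) → x ≤ₛ y → toℕ (x i) ≢ toℕ (y i) → weight x < weight y
  weight-< i x≤y xᵢ≢yᵢ = sum-map-< (allFinL n) x≤y (∈-allFinL i) (≤∧≢⇒< (x≤y i) xᵢ≢yᵢ)

violation : ∀ {a b c} → ¬ T (not (a ∧ not b) ∨ c) → T a × ¬ T b × ¬ T c
violation {true}  {false} {false} _ = _ , (λ ()) , (λ ())
violation {false}                 h = ⊥-elim (h _)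
violation {true}  {true}          h = ⊥-elim (h _)
violation {true}  {false} {true}  h = ⊥-elim (h _)

module _ {n : ℕ} {m : Fin n → ℕ} {M : ℕ} (φ : State m → Fin (suc M)) (φ-mono : Monotone φ) (k : ℕ) where

  -- the test that isMinPathᵇ φ k z applies to every state y
  minimalAgainst : State m → State m → Bool
  minimalAgainst z y = not (leₛᵇ y z ∧ not (eqₛᵇ y z)) ∨ (toℕ (φ y) <ᵇ k)

  minPath⇒≥k : {p : State m} → p ∈ minPaths φ k → k ≤ toℕ (φ p)
  minPath⇒≥k p∈ = ≤ᵇ⇒≤ k _ (proj₁ (Equivalence.to BP.T-∧ p-min))
    where
    p-min = proj₂ (∈-filter⁻ (T? ∘ isMinPathᵇ φ k) {xs = allStates m} p∈)

  nonminimal⇒lighter : (z : State m) → k ≤ toℕ (φ z) → ¬ T (isMinPathᵇ φ k z) →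
                       ∃[ y ] y ≤ₛ z × weight y < weight z × k ≤ toℕ (φ y)
  nonminimal⇒lighter z k≤φz z-nonmin
    with satisfied (¬All⇒Any¬ (T? ∘ minimalAgainst z) (allStates m)
                              (z-nonmin ∘ level-and-minimal ∘ all⁻ _))
    where
    level-and-minimal : T (all (minimalAgainst z) (allStates m)) → T (isMinPathᵇ φ k z)
    level-and-minimal minimal = Equivalence.from BP.T-∧ (≤⇒≤ᵇ k≤φz , minimal)
  ... | y , y-violates with violation y-violates
  ... | y≤ᵇz , y≢z , φy≮k with ¬eqₛᵇ⇒≢ {x = y} {y = z} y≢z
  ... | i , yᵢ≢zᵢ = y , y≤z , weight-< i y≤z yᵢ≢zᵢ , ≮⇒≥ (φy≮k ∘ <⇒<ᵇ)
    where
    y≤z : y ≤ₛ z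
    y≤z = leₛᵇ⇒≤ₛ y≤ᵇz

  minPath-below : (y : State m) → k ≤ toℕ (φ y) → ∃[ p ] p ∈ minPaths φ k × p ≤ₛ y
  minPath-below y = descend y (<-wellFounded (weight y))
    where
    descend : (y : State m) → Acc _<_ (weight y) → k ≤ toℕ (φ y) → ∃[ p ] p ∈ minPaths φ k × p ≤ₛ y
    descend y (acc rs) k≤φy with allStates-complete m y
    ... | z , z∈ , z≗y with T? (isMinPathᵇ φ k z)
    ... | yes z-min = z , ∈-filter⁺ (T? ∘ isMinPathᵇ φ k) z∈ z-min , ≗⇒≤ₛ z≗y
    ... | no z-nonmin
        with nonminimal⇒lighter z (≤-trans k≤φy (φ-mono y z (≗⇒≤ₛ (sym ∘ z≗y)))) z-nonmin
    ... | y' , y'≤z , y'<z , k≤φy'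
        with descend y' (rs (subst (weight y' <_) (weight-cong z≗y) y'<z)) k≤φy'
    ... | p , p∈ , p≤y' = p , p∈ , ≤ₛ-trans p≤y' (≤ₛ-trans y'≤z (≗⇒≤ₛ z≗y))

  φₖ-via-minPaths : (y : State m) → + φₖ φ k y ≡ when (any (λ p → leₛᵇ p y) (minPaths φ k)) 1ℤ
  φₖ-via-minPaths y =
    trans (BP.if-float +_ (k ≤ᵇ toℕ (φ y))) (cong (λ b → when b 1ℤ) (T-ext above below))
    where
    above : T (k ≤ᵇ toℕ (φ y)) → T (any (λ p → leₛᵇ p y) (minPaths φ k))
    above k≤φy with minPath-below y (≤ᵇ⇒≤ k _ k≤φy)
    ... | p , p∈ , p≤y = any⁺ _ (lose p∈ (≤ₛ⇒leₛᵇ p≤y))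
    below : T (any (λ p → leₛᵇ p y) (minPaths φ k)) → T (k ≤ᵇ toℕ (φ y))
    below some-p≤y with find (any⁻ _ (minPaths φ k) some-p≤y)
    ... | p , p∈ , p≤y = ≤⇒≤ᵇ (≤-trans (minPath⇒≥k p∈) (φ-mono p y (leₛᵇ⇒≤ₛ p≤y)))

-- The alternating sum over the box {m − 1, m}ⁿ

altSign : ∀ {n} → Subset n → ℤ
altSign {n} B = -1ℤ ^ (n ∸ ∣ B ∣)

altSign-outside : ∀ {n} (B : Subset n) → altSign (outside ∷ B) ≡ - altSign B
altSign-outside B = trans (cong (-1ℤ ^_) (+-∸-assoc 1 (∣p∣≤n B))) (ZP.-1*i≡-i _)

≤ᵇ-pred≡not-≡ᵇ : ∀ {t u} → 1 ≤ u → t ≤ u → (t ≤ᵇ u ∸ 1) ≡ not (t ≡ᵇ u)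
≤ᵇ-pred≡not-≡ᵇ {zero}        {suc u}       _ _                   = refl
≤ᵇ-pred≡not-≡ᵇ {suc zero}    {suc zero}    _ _                   = refl
≤ᵇ-pred≡not-≡ᵇ {suc zero}    {suc (suc u)} _ _                   = refl
≤ᵇ-pred≡not-≡ᵇ {suc (suc t)} {suc (suc u)} _ (s≤s t+1≤u+1) =
  ≤ᵇ-pred≡not-≡ᵇ (s≤s z≤n) t+1≤u+1

module _ {n : ℕ} {m : Fin (suc n) → ℕ} where

  leₛᵇ-∷ : (x y : State m) →
           leₛᵇ x y ≡ (toℕ (x zero) ≤ᵇ toℕ (y zero)) ∧ leₛᵇ (x ∘ suc) (y ∘ suc)
  leₛᵇ-∷ x y = cong (_∧_ (toℕ (x zero) ≤ᵇ toℕ (y zero))) (cong and (sym (LP.map-∘ (allFinL n))))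

  eqₛᵇ-∷ : (x y : State m) →
           eqₛᵇ x y ≡ (toℕ (x zero) ≡ᵇ toℕ (y zero)) ∧ eqₛᵇ (x ∘ suc) (y ∘ suc)
  eqₛᵇ-∷ x y = cong (_∧_ (toℕ (x zero) ≡ᵇ toℕ (y zero))) (cong and (sym (LP.map-∘ (allFinL n))))

  leₛᵇ-xOf-∷ : (z : State m) (b : Side) (B : Subset n) →
               leₛᵇ z (xOf m (b ∷ B))
                 ≡ (toℕ (z zero) ≤ᵇ toℕ (xOf m (b ∷ B) zero)) ∧ leₛᵇ (z ∘ suc) (xOf (m ∘ suc) B)
  leₛᵇ-xOf-∷ z b B = trans (leₛᵇ-∷ z (xOf m (b ∷ B))) (cong (_∧_ _) (all-cong tail-≤ (allFinL n)))
    where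
    xOf-suc : ∀ i → xOf m (b ∷ B) (suc i) ≡ xOf (m ∘ suc) B i
    xOf-suc i with lookup B i
    ... | inside  = refl
    ... | outside = refl
    tail-≤ : ∀ i → (toℕ (z (suc i)) ≤ᵇ toℕ (xOf m (b ∷ B) (suc i)))
                     ≡ (toℕ (z (suc i)) ≤ᵇ toℕ (xOf (m ∘ suc) B i))
    tail-≤ i = cong (λ v → toℕ (z (suc i)) ≤ᵇ toℕ v) (xOf-suc i)

∑-xOf-below : ∀ n (m : Fin n → ℕ) → (∀ i → 1 ≤ m i) → (z : State m) →
              ∑[ B ∈ allSubsets n ] when (leₛᵇ z (xOf m B)) (altSign B) ≡ when (eqₛᵇ z (topState m)) 1ℤ
∑-xOf-below zero    m _   z = refl
∑-xOf-below (suc n) m 1≤m z = begin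
  ∑ (map (inside ∷_) Bs ++ map (outside ∷_) Bs) F
    ≡⟨ ∑-++ (map (inside ∷_) Bs) (map (outside ∷_) Bs) F ⟩
  ∑ (map (inside ∷_) Bs) F + ∑ (map (outside ∷_) Bs) F
    ≡⟨ cong₂ _+_ (∑-map (inside ∷_) Bs F) (∑-map (outside ∷_) Bs F) ⟩
  (∑[ B ∈ Bs ] F (inside ∷ B)) + (∑[ B ∈ Bs ] F (outside ∷ B))
    ≡⟨ cong₂ _+_ (∑-cong inside-term Bs) (∑-cong outside-term Bs) ⟩
  ∑ Bs G + (∑[ B ∈ Bs ] when (not z₀-top) (- G B))
    ≡⟨ cong (_+_ (∑ Bs G)) (∑-when (not z₀-top) (-_ ∘ G) Bs) ⟩
  ∑ Bs G + when (not z₀-top) (∑[ B ∈ Bs ] - G B)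
    ≡⟨ cong (λ x → ∑ Bs G + when (not z₀-top) x) (∑-neg G Bs) ⟩
  ∑ Bs G + when (not z₀-top) (- ∑ Bs G)
    ≡⟨ cancel z₀-top (∑ Bs G) ⟩
  when z₀-top (∑ Bs G)
    ≡⟨ cong (when z₀-top) (∑-xOf-below n (m ∘ suc) (1≤m ∘ suc) (z ∘ suc)) ⟩
  when z₀-top (when (eqₛᵇ (z ∘ suc) (topState (m ∘ suc))) 1ℤ)
    ≡⟨ sym (when-∧ z₀-top _ 1ℤ) ⟩
  when (z₀-top ∧ eqₛᵇ (z ∘ suc) (topState (m ∘ suc))) 1ℤ
    ≡⟨ cong (λ b → when b 1ℤ) (sym z-top) ⟩
  when (eqₛᵇ z (topState m)) 1ℤ ∎
  where
  open ≡-Reasoning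
  Bs : List (Subset n)
  Bs = allSubsets n
  F : Subset (suc n) → ℤ
  F B = when (leₛᵇ z (xOf m B)) (altSign B)
  tail-below : Subset n → Bool
  tail-below B = leₛᵇ (z ∘ suc) (xOf (m ∘ suc) B)
  G : Subset n → ℤ
  G B = when (tail-below B) (altSign B)
  z₀-top : Bool
  z₀-top = toℕ (z zero) ≡ᵇ m zero
  z-top : eqₛᵇ z (topState m) ≡ z₀-top ∧ eqₛᵇ (z ∘ suc) (topState (m ∘ suc))
  z-top = trans (eqₛᵇ-∷ z (topState m))
                (cong (λ t → (toℕ (z zero) ≡ᵇ t) ∧ eqₛᵇ (z ∘ suc) (topState (m ∘ suc)))
                      (FP.toℕ-fromℕ (m zero)))
  z₀-below-m₀ : ∀ B → (toℕ (z zero) ≤ᵇ toℕ (xOf m (inside ∷ B) zero)) ≡ true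
  z₀-below-m₀ _ = Equivalence.to BP.T-≡ (≤⇒≤ᵇ (FP.≤fromℕ (z zero)))
  z₀-below-m₀-1 : ∀ B → (toℕ (z zero) ≤ᵇ toℕ (xOf m (outside ∷ B) zero)) ≡ not z₀-top
  z₀-below-m₀-1 _ = trans (cong (toℕ (z zero) ≤ᵇ_) (FP.toℕ-fromℕ< _))
                          (≤ᵇ-pred≡not-≡ᵇ (1≤m zero) (FP.toℕ≤pred[n] (z zero)))
  inside-term : ∀ B → F (inside ∷ B) ≡ G B
  inside-term B =
    cong (λ b → when b (altSign B))
         (trans (leₛᵇ-xOf-∷ z inside B) (cong (_∧ tail-below B) (z₀-below-m₀ B)))
  outside-term : ∀ B → F (outside ∷ B) ≡ when (not z₀-top) (- G B)
  outside-term B = begin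
    F (outside ∷ B)
      ≡⟨ cong₂ when (trans (leₛᵇ-xOf-∷ z outside B) (cong (_∧ tail-below B) (z₀-below-m₀-1 B)))
                    (altSign-outside B) ⟩
    when (not z₀-top ∧ tail-below B) (- altSign B)
      ≡⟨ when-∧ (not z₀-top) (tail-below B) _ ⟩
    when (not z₀-top) (when (tail-below B) (- altSign B))
      ≡⟨ cong (when (not z₀-top)) (when-neg (tail-below B) _) ⟩
    when (not z₀-top) (- G B) ∎
  cancel : ∀ b x → x + when (not b) (- x) ≡ when b x
  cancel true  x = ZP.+-identityʳ x
  cancel false x = ZP.+-inverseʳ x

formationSign : ∀ {n} {m : Fin n → ℕ} → List (State m) → State m → ℤ
formationSign S x = if joinIsᵇ S x then paritySign (length S) else + 0

formationSign-top : ∀ {n} {m : Fin n → ℕ} → (∀ i → 1 ≤ m i) → (S : List (State m)) →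
                    formationSign S (topState m)
                      ≡ ∑[ B ∈ allSubsets n ] signedAll⁺ (λ p → leₛᵇ p (xOf m B)) S * altSign B
formationSign-top {n} {m} _   []      = sym (∑-zero (allSubsets n))
formationSign-top {n} {m} 1≤m (s ∷ S) = begin
  when (eqₛᵇ J (topState m)) σ
    ≡⟨ when-1 (eqₛᵇ J (topState m)) σ ⟩
  σ * when (eqₛᵇ J (topState m)) 1ℤ
    ≡⟨ cong (σ *_) (sym (∑-xOf-below n m 1≤m J)) ⟩
  σ * (∑[ B ∈ allSubsets n ] when (leₛᵇ J (xOf m B)) (altSign B))
    ≡⟨ ∑-*ˡ σ _ (allSubsets n) ⟩
  ∑[ B ∈ allSubsets n ] σ * when (leₛᵇ J (xOf m B)) (altSign B)
    ≡⟨ ∑-cong (λ B → when-*-comm (leₛᵇ J (xOf m B)) σ (altSign B)) (allSubsets n) ⟩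
  ∑[ B ∈ allSubsets n ] when (leₛᵇ J (xOf m B)) σ * altSign B
    ≡⟨ ∑-cong (λ B → cong (λ b → when b σ * altSign B) (leₛᵇ-join s S (xOf m B))) (allSubsets n) ⟩
  ∑[ B ∈ allSubsets n ] signedAll⁺ (λ p → leₛᵇ p (xOf m B)) (s ∷ S) * altSign B ∎
  where
  open ≡-Reasoning
  J : State m
  J = foldr _∨ₛ_ s S
  σ : ℤ
  σ = paritySign (length (s ∷ S))

corollary4p3 : (n : ℕ) (m : Fin n → ℕ) → (∀ i → 1 ≤ m i) →
               (M : ℕ) (φ : State m → Fin (suc M)) → Monotone φ →
               (k : ℕ) → 1 ≤ k → k ≤ M →
               signedDomination φ k ≡ rhs φ k
corollary4p3 n m 1≤m M φ φ-mono k _ _ = begin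
  ∑[ S ∈ sublists P ] formationSign S (topState m)
    ≡⟨ ∑-cong (formationSign-top 1≤m) (sublists P) ⟩
  ∑[ S ∈ sublists P ] ∑[ B ∈ Bs ] signedAll⁺ (below B) S * altSign B
    ≡⟨ ∑-comm (λ S B → signedAll⁺ (below B) S * altSign B) (sublists P) Bs ⟩
  ∑[ B ∈ Bs ] ∑[ S ∈ sublists P ] signedAll⁺ (below B) S * altSign B
    ≡⟨ ∑-cong (λ B → sym (∑-*ʳ (altSign B) (signedAll⁺ (below B)) (sublists P))) Bs ⟩
  ∑[ B ∈ Bs ] ∑ (sublists P) (signedAll⁺ (below B)) * altSign B
    ≡⟨ ∑-cong (λ B → cong (_* altSign B) (∑-sublists-signedAll⁺ (below B) P)) Bs ⟩
  ∑[ B ∈ Bs ] when (any (below B) P) 1ℤ * altSign B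
    ≡⟨ ∑-cong (λ B → cong (_* altSign B) (sym (φₖ-via-minPaths φ φ-mono k (xOf m B)))) Bs ⟩
  rhs φ k ∎
  where
  open ≡-Reasoning
  P : List (State m)
  P = minPaths φ k
  Bs : List (Subset n)
  Bs = allSubsets n
  below : Subset n → State m → Bool
  below B p = leₛᵇ p (xOf m B)
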